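{- Let $T_n$ denote the complete binary tree of depth $n\ge 1$. Then $\mathsf{DL}(T_n)= n$.
   Context: $T_n$ has vertex set consisting of all binary strings of length $0,1,\dots,n$, with an edge joining two strings if one is obtained from the other by deleting its rightmost bit. For a finite connected graph $G=(V,E)$ with $|V|=N$ and graph distance $d$, a $k$-dispersed labelling is a bijection $\phi:\{1,\dots,N\}\to V$ with $d(\phi(i),\phi(i+1))\ge k$ for $1\le i\le N-1$; $\mathsf{DL}(G)$ is the maximum such $k$. -}

module Defs where

open import Data.Nat using (ℕ; zero; suc; _≤_)
open import Data.Bool using (Bool)
open import Data.List using (List; length; _++_; [_])
open import Data.Sum using (_⊎_)
open import Data.Product using (Σ; ∃; _×_; _,_; proj₁)
open import Data.Fin using (Fin; toℕ)
open import Function.Bundles using (_⤖_; Bijection)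
open import Relation.Binary.PropositionalEquality using (_≡_)

data Walk {V : Set} (Adj : V → V → Set) : V → V → ℕ → Set where
  here : ∀ {u} → Walk Adj u u 0
  step : ∀ {u v w ℓ} → Adj u v → Walk Adj v w ℓ → Walk Adj u w (suc ℓ)

DistGE : {V : Set} (Adj : V → V → Set) → V → V → ℕ → Set
DistGE Adj u v k = ∀ ℓ → Walk Adj u v ℓ → k ≤ ℓ

-- A k-dispersed labelling: a bijection φ from {1..N} (here Fin N, 0-based)
-- onto the vertex set, with consecutive labels at distance ≥ k.
DispersedLabelling : {V : Set} (Adj : V → V → Set) (N : ℕ) → Fin N ⤖ V → ℕ → Set
DispersedLabelling Adj N φ k =
  ∀ (i j : Fin N) → toℕ j ≡ suc (toℕ i) →
    DistGE Adj (Bijection.to φ i) (Bijection.to φ j) k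

HasDispersed : {V : Set} (Adj : V → V → Set) → ℕ → Set
HasDispersed {V} Adj k = ∃ λ N → Σ (Fin N ⤖ V) λ φ → DispersedLabelling Adj N φ k

IsDL : {V : Set} (Adj : V → V → Set) → ℕ → Set
IsDL Adj k = HasDispersed Adj k × (∀ k' → HasDispersed Adj k' → k' ≤ k)

TVertex : ℕ → Set
TVertex n = Σ (List Bool) λ s → length s ≤ n

TAdj : (n : ℕ) → TVertex n → TVertex n → Set
TAdj n u v = (∃ λ b → proj₁ v ≡ proj₁ u ++ [ b ]) ⊎ (∃ λ b → proj₁ u ≡ proj₁ v ++ [ b ])

-- Upper bound: the root is within distance n of every vertex, and in any labelling the root's label has a
-- neighbouring label, which then lies at distance at most n from it.
-- Lower bound, n = m + 1: for a child c of the root, the depth signed by the side of c (positive below c,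
-- negative elsewhere) changes by exactly one along every edge, so vertices on different sides of the root
-- are at distance at least the sum of their depths. List the root, then alternate the leaves below true
-- with the inner vertices below false, then the leaves below false with the inner vertices below true:
-- each consecutive pair lies across the root and contains a leaf, of depth m + 1. Each side has one leaf
-- more than inner vertices, and counting occurrences shows that every vertex is listed exactly once.
module Submission where

open import Defs
open import Data.Nat using (ℕ; zero; suc; _+_; _≤_; _<_; z≤n; s≤s; s≤s⁻¹)
open import Data.Nat.Properties
  using ( ≤-refl; ≤-reflexive; ≤-trans; <-≤-trans; ≤-irrelevant; n≤1+n; m≤n+m; m≤n⇒m≤1+n; m<n⇒m<1+n
        ; m≤n⇒m<n∨m≡n; <⇒≤; <⇒≱; <⇒≢; >⇒≢; suc-injective; +-comm; +-identityʳ; +-mono-≤; m+n∸n≡m)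
open import Data.Integer.Base as ℤ using (ℤ; +_; -_; _-_; _⊖_; ∣_∣)
import Data.Integer.Properties as ℤ
open import Data.Bool using (Bool; true; false; if_then_else_; _≟_)
open import Data.Maybe using (just)
open import Data.Maybe.Properties using (just-injective)
open import Data.List using (List; []; _∷_; _++_; [_]; map; length; lookup; head)
open import Data.List.Properties using (length-++; length-map; ++-identityʳ; ∷-injectiveˡ; ∷-injectiveʳ; ≡-dec)
open import Data.List.Membership.Propositional.Properties using (∈-lookup)
open import Data.List.Relation.Unary.All as All using (All; []; _∷_)
open import Data.List.Relation.Unary.All.Properties using () renaming (++⁺ to All-++⁺; map⁺ to All-map⁺)
open import Data.List.Relation.Unary.Linked using (Linked; [-]; _∷_)
open import Data.Fin using (Fin; zero; suc; toℕ; inject₁)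
open import Data.Fin.Properties using (toℕ-inject₁)
open import Data.Product using (Σ; ∃; _×_; _,_; proj₁; proj₂; map₂)
open import Data.Product.Properties using (Σ-≡,≡→≡)
import Data.Sum as Sum
open import Data.Sum using (_⊎_; inj₁; inj₂)
open import Relation.Nullary using (does; yes; no; contradiction)
open import Relation.Nullary.Decidable using (dec-true; dec-false)
open import Relation.Unary using (Irrelevant)
open import Relation.Binary.Core using (_=[_]⇒_)
open import Relation.Binary.Definitions using (Symmetric; DecidableEquality)
open import Relation.Binary.PropositionalEquality
  using (_≡_; _≢_; refl; sym; trans; cong; cong₂; subst; module ≡-Reasoning)
open import Function using (_∘_)
open import Function.Bundles using (_⤖_; Bijection; mk⤖)
open import Function.Definitions using (Injective; Surjective)

Walk-map : ∀ {V W : Set} {A : V → V → Set} {B : W → W → Set} (f : V → W) → A =[ f ]⇒ B →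
           ∀ {u v ℓ} → Walk A u v ℓ → Walk B (f u) (f v) ℓ
Walk-map f hom here        = here
Walk-map f hom (step a ws) = step (hom a) (Walk-map f hom ws)

module _ {V : Set} {Adj : V → V → Set} where

  Walk-snoc : ∀ {u v w ℓ} → Walk Adj u v ℓ → Adj v w → Walk Adj u w (suc ℓ)
  Walk-snoc here        a = step a here
  Walk-snoc (step b ws) a = step b (Walk-snoc ws a)

  Walk-reverse : Symmetric Adj → ∀ {u v ℓ} → Walk Adj u v ℓ → Walk Adj v u ℓ
  Walk-reverse sym here        = here
  Walk-reverse sym (step a ws) = Walk-snoc (Walk-reverse sym ws) (sym a)

  DistGE-sym : Symmetric Adj → ∀ {u v k} → DistGE Adj u v k → DistGE Adj v u k
  DistGE-sym sym d ℓ ws = d ℓ (Walk-reverse sym ws)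

  module _ (f : V → ℤ) (lipschitz : ∀ {u v} → Adj u v → ∣ f v - f u ∣ ≤ 1) where

    walk-displacement : ∀ {u v ℓ} → Walk Adj u v ℓ → ∣ f v - f u ∣ ≤ ℓ
    walk-displacement {u} here = ≤-reflexive (cong ∣_∣ (ℤ.+-inverseʳ (f u)))
    walk-displacement {u} (step {v = v} {w} {ℓ} a ws) = begin
      ∣ f w - f u ∣                    ≡⟨ cong ∣_∣ (ℤ.+-minus-telescope (f w) (f v) (f u)) ⟨
      ∣ (f w - f v) ℤ.+ (f v - f u) ∣  ≤⟨ ℤ.∣i+j∣≤∣i∣+∣j∣ (f w - f v) (f v - f u) ⟩
      ∣ f w - f v ∣ + ∣ f v - f u ∣    ≤⟨ +-mono-≤ (walk-displacement ws) (lipschitz a) ⟩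
      ℓ + 1                            ≡⟨ +-comm ℓ 1 ⟩
      suc ℓ                            ∎
      where open Data.Nat.Properties.≤-Reasoning

    DistGE-potential : ∀ {u v k} → k ≤ ∣ f v - f u ∣ → DistGE Adj u v k
    DistGE-potential k≤gap ℓ ws = ≤-trans k≤gap (walk-displacement ws)

Fin-neighbour : ∀ {N} (i i′ : Fin N) → i ≢ i′ →
                Σ (Fin N) λ j → toℕ j ≡ suc (toℕ i) ⊎ toℕ i ≡ suc (toℕ j)
Fin-neighbour zero    zero          i≢i′ = contradiction refl i≢i′
Fin-neighbour zero    (suc zero)    _    = suc zero , inj₁ refl
Fin-neighbour zero    (suc (suc _)) _    = suc zero , inj₁ refl
Fin-neighbour (suc i) _             _    = inject₁ i , inj₂ (cong suc (sym (toℕ-inject₁ i)))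

dispersion≤eccentricity : ∀ {V : Set} {Adj : V → V → Set} {k e} → Symmetric Adj → (r v : V) → r ≢ v →
                          (∀ w → ∃ λ ℓ → ℓ ≤ e × Walk Adj r w ℓ) → HasDispersed Adj k → k ≤ e
dispersion≤eccentricity {Adj = Adj} {k} {e} Adj-sym r v r≢v reach (N , φ , dispersed) =
  from-neighbour (Fin-neighbour i i′ i≢i′)
  where
  open Bijection φ using (to; surjective)
  i i′ : Fin N
  i  = proj₁ (surjective r)
  i′ = proj₁ (surjective v)
  to-i : to i ≡ r
  to-i = proj₂ (surjective r) refl
  i≢i′ : i ≢ i′
  i≢i′ i≡i′ = r≢v (trans (sym to-i) (trans (cong to i≡i′) (proj₂ (surjective v) refl)))
  within-reach : ∀ {w} → DistGE Adj r w k → k ≤ e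
  within-reach {w} far with ℓ , ℓ≤e , walk ← reach w = ≤-trans (far ℓ walk) ℓ≤e
  from-neighbour : (Σ (Fin N) λ j → toℕ j ≡ suc (toℕ i) ⊎ toℕ i ≡ suc (toℕ j)) → k ≤ e
  from-neighbour (j , inj₁ j≡1+i) =
    within-reach (subst (λ u → DistGE Adj u (to j) k) to-i (dispersed i j j≡1+i))
  from-neighbour (j , inj₂ i≡1+j) =
    within-reach (DistGE-sym Adj-sym (subst (λ u → DistGE Adj (to j) u k) to-i (dispersed j i i≡1+j)))

interleave : ∀ {A : Set} → List A → List A → List A
interleave []       ys = ys
interleave (x ∷ xs) ys = x ∷ interleave ys xs

All-interleave⁺ : ∀ {A : Set} {P : A → Set} {xs ys} → All P xs → All P ys → All P (interleave xs ys)
All-interleave⁺ []         pys = pys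
All-interleave⁺ (px ∷ pxs) pys = px ∷ All-interleave⁺ pys pxs

module _ {A : Set} {R : A → A → Set} {P Q : A → Set}
         (PQ : ∀ {x y} → P x → Q y → R x y) (QP : ∀ {x y} → P x → Q y → R y x) where

  Linked-interleave⁺ : ∀ {w xs ys zs} → (∀ {x} → P x → R w x) → All P xs → All Q ys →
                       length xs ≡ suc (length ys) → (∀ {x} → P x → Linked R (x ∷ zs)) →
                       Linked R (w ∷ interleave xs ys ++ zs)
  Linked-interleave⁺ Rw (px ∷ [])  []         refl        continue = Rw px ∷ continue px
  Linked-interleave⁺ Rw (px ∷ pxs) (qy ∷ qys) |xs|≡1+|ys| continue =
    Rw px ∷ PQ px qy ∷
    Linked-interleave⁺ (λ px′ → QP px′ qy) pxs qys (suc-injective |xs|≡1+|ys|) continue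

Linked-lookup : ∀ {A : Set} {R : A → A → Set} {xs} → Linked R xs →
                ∀ i j → toℕ j ≡ suc (toℕ i) → R (lookup xs i) (lookup xs j)
Linked-lookup (r ∷ _)  zero    (suc zero) _ = r
Linked-lookup (_ ∷ rs) (suc i) (suc j)    e = Linked-lookup rs i j (suc-injective e)

module Counting {A : Set} (_≟ₐ_ : DecidableEquality A) where

  count : A → List A → ℕ
  count a []       = 0
  count a (x ∷ xs) = if does (a ≟ₐ x) then suc (count a xs) else count a xs

  count-here : ∀ x xs → count x (x ∷ xs) ≡ suc (count x xs)
  count-here x xs rewrite dec-true (x ≟ₐ x) refl = refl

  count-∷-≤ : ∀ a x xs → count a xs ≤ count a (x ∷ xs)
  count-∷-≤ a x xs with does (a ≟ₐ x)
  ... | true  = n≤1+n _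
  ... | false = ≤-refl

  count-++ : ∀ a xs ys → count a (xs ++ ys) ≡ count a xs + count a ys
  count-++ a []       ys = refl
  count-++ a (x ∷ xs) ys with does (a ≟ₐ x)
  ... | true  = cong suc (count-++ a xs ys)
  ... | false = count-++ a xs ys

  count-interleave : ∀ a xs ys → count a (interleave xs ys) ≡ count a xs + count a ys
  count-interleave a []       ys = refl
  count-interleave a (x ∷ xs) ys with does (a ≟ₐ x)
  ... | true  = cong suc (trans (count-interleave a ys xs) (+-comm (count a ys) (count a xs)))
  ... | false = trans (count-interleave a ys xs) (+-comm (count a ys) (count a xs))

  count-map-injective : ∀ {f : A → A} → Injective _≡_ _≡_ f →
                        ∀ a xs → count (f a) (map f xs) ≡ count a xs
  count-map-injective f-inj a [] = refl
  count-map-injective {f} f-inj a (x ∷ xs) with f a ≟ₐ f x | a ≟ₐ x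
  ... | yes _     | yes _   = cong suc (count-map-injective f-inj a xs)
  ... | no _      | no _    = count-map-injective f-inj a xs
  ... | yes fa≡fx | no a≢x  = contradiction (f-inj fa≡fx) a≢x
  ... | no fa≢fx  | yes a≡x = contradiction (cong f a≡x) fa≢fx

  count-map-∉ : ∀ {f : A → A} a xs → (∀ x → f x ≢ a) → count a (map f xs) ≡ 0
  count-map-∉ a []           _   = refl
  count-map-∉ {f} a (x ∷ xs) f≢a with a ≟ₐ f x
  ... | yes a≡fx = contradiction (sym a≡fx) (f≢a x)
  ... | no _     = count-map-∉ a xs f≢a

  count-lookup : ∀ xs i → 0 < count (lookup xs i) xs
  count-lookup (x ∷ xs) zero    = subst (0 <_) (sym (count-here x xs)) (s≤s z≤n)
  count-lookup (x ∷ xs) (suc i) = <-≤-trans (count-lookup xs i) (count-∷-≤ _ x xs)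

  lookup-injective : ∀ xs → (∀ i → count (lookup xs i) xs ≤ 1) →
                     ∀ {i j} → lookup xs i ≡ lookup xs j → i ≡ j
  lookup-injective (x ∷ xs) once {zero}  {zero}  _ = refl
  lookup-injective (x ∷ xs) once {zero}  {suc j} x≡xⱼ =
    contradiction (s≤s⁻¹ (subst (_≤ 1) (count-here x xs) (once zero)))
                  (<⇒≱ (subst (λ a → 0 < count a xs) (sym x≡xⱼ) (count-lookup xs j)))
  lookup-injective (x ∷ xs) once {suc i} {zero}  xᵢ≡x = sym (lookup-injective (x ∷ xs) once (sym xᵢ≡x))
  lookup-injective (x ∷ xs) once {suc i} {suc j} xᵢ≡xⱼ =
    cong suc (lookup-injective xs (λ k → ≤-trans (count-∷-≤ _ x xs) (once (suc k))) xᵢ≡xⱼ)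

  count-pos⇒lookup : ∀ a xs → 0 < count a xs → ∃ λ i → lookup xs i ≡ a
  count-pos⇒lookup a (x ∷ xs) pos with a ≟ₐ x
  ... | yes a≡x = zero , sym a≡x
  ... | no _    with i , xᵢ≡a ← count-pos⇒lookup a xs pos = suc i , xᵢ≡a

  lookup⤖ : ∀ {P : A → Set} xs → All P xs → (∀ {a} → P a → count a xs ≡ 1) → Irrelevant P →
            Fin (length xs) ⤖ Σ A P
  lookup⤖ {P} xs all once irr = mk⤖ {to = to} (injective , surjective)
    where
    to : Fin (length xs) → Σ A P
    to i = lookup xs i , All.lookup all (∈-lookup i)
    injective : Injective _≡_ _≡_ to
    injective e = lookup-injective xs (λ i → ≤-reflexive (once (proj₂ (to i)))) (cong proj₁ e)
    surjective : Surjective _≡_ _≡_ to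
    surjective (a , pa) with i , xᵢ≡a ← count-pos⇒lookup a xs (≤-reflexive (sym (once pa))) =
      i , λ { refl → Σ-≡,≡→≡ (xᵢ≡a , irr _ _) }

root : ∀ {n} → TVertex n
root = [] , z≤n

child-embedding : ∀ {n} → Bool → TVertex n → TVertex (suc n)
child-embedding x (s , p) = x ∷ s , s≤s p

TAdj-child : ∀ {n} x {u v} → TAdj n u v → TAdj (suc n) (child-embedding x u) (child-embedding x v)
TAdj-child x = Sum.map (map₂ (cong (x ∷_))) (map₂ (cong (x ∷_)))

TAdj-sym : ∀ {n} → Symmetric (TAdj n)
TAdj-sym = Sum.swap

-- TAdj n u v does not determine u and v, so implicit vertex arguments are passed by hand below.
walk-from-root : ∀ {n} s (p : length s ≤ n) → Walk (TAdj n) root (s , p) (length s)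
walk-from-root []      z≤n     = here
walk-from-root {suc n} (x ∷ s) (s≤s p) =
  step (inj₁ (x , refl))
       (Walk-map (child-embedding x) (λ {u} {v} → TAdj-child x {u} {v}) (walk-from-root s p))

sidedDepth : Bool → List Bool → ℤ
sidedDepth c []      = + 0
sidedDepth c (x ∷ s) = if does (x ≟ c) then + length (x ∷ s) else - + length (x ∷ s)

sidedDepth-inside : ∀ {c s} → head s ≡ just c → sidedDepth c s ≡ + length s
sidedDepth-inside {c} {.c ∷ s} refl rewrite dec-true (c ≟ c) refl = refl

sidedDepth-outside : ∀ {c s} → head s ≢ just c → sidedDepth c s ≡ - + length s
sidedDepth-outside {c} {[]}    _  = refl
sidedDepth-outside {c} {x ∷ s} ≢c rewrite dec-false (x ≟ c) (≢c ∘ cong just) = refl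

∣1+m⊖m∣≡1 : ∀ m → ∣ suc m ⊖ m ∣ ≡ 1
∣1+m⊖m∣≡1 m = trans (cong ∣_∣ (ℤ.⊖-≥ (n≤1+n m))) (m+n∸n≡m 1 m)

sidedDepth-snoc : ∀ c s b → ∣ sidedDepth c (s ++ [ b ]) - sidedDepth c s ∣ ≡ 1
sidedDepth-snoc c []      b with does (b ≟ c)
... | true  = refl
... | false = refl
sidedDepth-snoc c (x ∷ s) b rewrite length-++ s {[ b ]} | +-comm (length s) 1 with does (x ≟ c)
... | true  = ∣1+m⊖m∣≡1 (suc (length s))
... | false = trans (ℤ.∣m⊖n∣≡∣n⊖m∣ (suc (length s)) (suc (suc (length s))))
                    (∣1+m⊖m∣≡1 (suc (length s)))

sidedDepth-Lipschitz : ∀ {n} c {u v} → TAdj n u v →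
                       ∣ sidedDepth c (proj₁ v) - sidedDepth c (proj₁ u) ∣ ≤ 1
sidedDepth-Lipschitz c {s , _} (inj₁ (b , refl)) = ≤-reflexive (sidedDepth-snoc c s b)
sidedDepth-Lipschitz c {_ , _} {t , _} (inj₂ (b , refl)) =
  ≤-reflexive (trans (ℤ.∣i-j∣≡∣j-i∣ (sidedDepth c t) _) (sidedDepth-snoc c t b))

DistGE-across : ∀ {n c s t k} {p q} → head s ≡ just c → head t ≢ just c → k ≤ length t + length s →
                DistGE (TAdj n) (s , p) (t , q) k
DistGE-across {n} {c} {s} {t} {k} s-inside t-outside k≤ =
  DistGE-potential (sidedDepth c ∘ proj₁) (λ {u} {v} → sidedDepth-Lipschitz {n} c {u} {v})
                   (subst (k ≤_) (sym gap) k≤)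
  where
  open ≡-Reasoning
  gap : ∣ sidedDepth c t - sidedDepth c s ∣ ≡ length t + length s
  gap = begin
    ∣ sidedDepth c t - sidedDepth c s ∣  ≡⟨ cong₂ (λ a b → ∣ a - b ∣) (sidedDepth-outside t-outside)
                                                                       (sidedDepth-inside s-inside) ⟩
    ∣ - + length t - + length s ∣         ≡⟨ cong ∣_∣ (ℤ.neg-distrib-+ (+ length t) (+ length s)) ⟨
    ∣ - (+ length t ℤ.+ + length s) ∣    ≡⟨ ℤ.∣-i∣≡∣i∣ (+ length t ℤ.+ + length s) ⟩
    length t + length s                  ∎

strings : ℕ → List (List Bool)
strings zero    = [ [] ]
strings (suc k) = map (false ∷_) (strings k) ++ map (true ∷_) (strings k)

below : ℕ → List (List Bool)
below zero    = []
below (suc k) = below k ++ strings k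

All-strings : ∀ k → All (λ s → length s ≡ k) (strings k)
All-strings zero    = refl ∷ []
All-strings (suc k) = All-++⁺ (All-map⁺ (All.map (cong suc) (All-strings k)))
                              (All-map⁺ (All.map (cong suc) (All-strings k)))

All-below : ∀ k → All (λ s → length s < k) (below k)
All-below zero    = []
All-below (suc k) = All-++⁺ (All.map m<n⇒m<1+n (All-below k))
                            (All.map (s≤s ∘ ≤-reflexive) (All-strings k))

length-strings : ∀ k → length (strings k) ≡ suc (length (below k))
length-strings zero    = refl
length-strings (suc k) = begin
  length (map (false ∷_) S ++ map (true ∷_) S)         ≡⟨ length-++ (map (false ∷_) S) ⟩
  length (map (false ∷_) S) + length (map (true ∷_) S) ≡⟨ cong₂ _+_ (length-map _ S) (length-map _ S) ⟩
  length S + length S                                   ≡⟨ cong (_+ length S) (length-strings k) ⟩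
  suc (length (below k) + length S)                     ≡⟨ cong suc (length-++ (below k)) ⟨
  suc (length (below k ++ S))                           ∎
  where
  open ≡-Reasoning
  S = strings k

open Counting (≡-dec _≟_)

count-∷-map : ∀ x s c xs → count (x ∷ s) (map (c ∷_) xs) ≡ (if does (x ≟ c) then count s xs else 0)
count-∷-map x s c xs with x ≟ c
... | yes refl = count-map-injective ∷-injectiveʳ s xs
... | no x≢c   = count-map-∉ (x ∷ s) xs (λ _ c∷≡x∷ → x≢c (sym (∷-injectiveˡ c∷≡x∷)))

count-[]-map : ∀ c xs → count [] (map (c ∷_) xs) ≡ 0
count-[]-map c xs = count-map-∉ [] xs (λ _ ())

count-∷-strings : ∀ x s k → count (x ∷ s) (strings (suc k)) ≡ count s (strings k)
count-∷-strings x s k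
  rewrite count-++ (x ∷ s) (map (false ∷_) (strings k)) (map (true ∷_) (strings k))
        | count-∷-map x s false (strings k) | count-∷-map x s true (strings k) with x
... | false = +-identityʳ _
... | true  = refl

count-strings-length : ∀ s → count s (strings (length s)) ≡ 1
count-strings-length []      = refl
count-strings-length (x ∷ s) = trans (count-∷-strings x s (length s)) (count-strings-length s)

count-strings-other : ∀ s k → length s ≢ k → count s (strings k) ≡ 0
count-strings-other []      zero    ≢k = contradiction refl ≢k
count-strings-other []      (suc k) _
  rewrite count-++ [] (map (false ∷_) (strings k)) (map (true ∷_) (strings k))
        | count-[]-map false (strings k) | count-[]-map true (strings k) = refl
count-strings-other (x ∷ s) zero    _  = refl
count-strings-other (x ∷ s) (suc k) ≢k =
  trans (count-∷-strings x s k) (count-strings-other s k (≢k ∘ cong suc))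

count-below-≥ : ∀ s k → k ≤ length s → count s (below k) ≡ 0
count-below-≥ s zero    _  = refl
count-below-≥ s (suc k) k<|s| =
  trans (count-++ s (below k) (strings k))
        (cong₂ _+_ (count-below-≥ s k (<⇒≤ k<|s|)) (count-strings-other s k (>⇒≢ k<|s|)))

count-below-< : ∀ s k → length s < k → count s (below k) ≡ 1
count-below-< s (suc k) |s|<1+k with m≤n⇒m<n∨m≡n (s≤s⁻¹ |s|<1+k)
... | inj₁ |s|<k = trans (count-++ s (below k) (strings k))
                         (cong₂ _+_ (count-below-< s k |s|<k) (count-strings-other s k (<⇒≢ |s|<k)))
... | inj₂ refl  = trans (count-++ s (below k) (strings k))
                         (cong₂ _+_ (count-below-≥ s k ≤-refl) (count-strings-length s))

zigzag : ℕ → Bool → Bool → List (List Bool)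
zigzag m c d = interleave (map (c ∷_) (strings m)) (map (d ∷_) (below m))

labels : ℕ → List (List Bool)
labels m = [] ∷ zigzag m true false ++ zigzag m false true

module _ (m : ℕ) where

  count-∷-zigzag : ∀ x s c d → count (x ∷ s) (zigzag m c d) ≡
                   (if does (x ≟ c) then count s (strings m) else 0) +
                   (if does (x ≟ d) then count s (below m) else 0)
  count-∷-zigzag x s c d =
    trans (count-interleave (x ∷ s) (map (c ∷_) (strings m)) (map (d ∷_) (below m)))
          (cong₂ _+_ (count-∷-map x s c (strings m)) (count-∷-map x s d (below m)))

  count-[]-zigzag : ∀ c d → count [] (zigzag m c d) ≡ 0
  count-[]-zigzag c d =
    trans (count-interleave [] (map (c ∷_) (strings m)) (map (d ∷_) (below m)))
          (cong₂ _+_ (count-[]-map c (strings m)) (count-[]-map d (below m)))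

  count-∷-labels : ∀ x s → count (x ∷ s) (labels m) ≡ count s (below (suc m))
  count-∷-labels x s
    rewrite count-++ (x ∷ s) (zigzag m true false) (zigzag m false true)
          | count-∷-zigzag x s true false | count-∷-zigzag x s false true
          | count-++ s (below m) (strings m) with x
  ... | true  = trans (cong (_+ count s (below m)) (+-identityʳ (count s (strings m))))
                      (+-comm (count s (strings m)) (count s (below m)))
  ... | false = cong₂ _+_ (refl {x = count s (below m)}) (+-identityʳ (count s (strings m)))

  count-labels : ∀ {s} → length s ≤ suc m → count s (labels m) ≡ 1
  count-labels {[]} _ =
    cong suc (trans (count-++ [] (zigzag m true false) (zigzag m false true))
                    (cong₂ _+_ (count-[]-zigzag true false) (count-[]-zigzag false true)))
  count-labels {x ∷ s} |s|<1+m = trans (count-∷-labels x s) (count-below-< s (suc m) |s|<1+m)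

  labels-bounded : All (λ s → length s ≤ suc m) (labels m)
  labels-bounded = z≤n ∷ All-++⁺ (zigzag-bounded true false) (zigzag-bounded false true)
    where
    zigzag-bounded : ∀ c d → All (λ s → length s ≤ suc m) (zigzag m c d)
    zigzag-bounded c d = All-interleave⁺ (All-map⁺ (All.map (s≤s ∘ ≤-reflexive) (All-strings m)))
                                         (All-map⁺ (All.map m≤n⇒m≤1+n (All-below m)))

  Far : List Bool → List Bool → Set
  Far s t = ∀ {p q} → DistGE (TAdj (suc m)) (s , p) (t , q) (suc m)

  Leaf : Bool → List Bool → Set
  Leaf c s = head s ≡ just c × length s ≡ suc m

  Outside : Bool → List Bool → Set
  Outside c t = head t ≢ just c

  far-from-leaf : ∀ {c s t} → Leaf c s → Outside c t → Far s t
  far-from-leaf {s = s} {t} (s-inside , |s|≡1+m) t-outside =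
    DistGE-across s-inside t-outside
                  (subst (_≤ length t + length s) |s|≡1+m (m≤n+m (length s) (length t)))

  far-to-leaf : ∀ {c s t} → Leaf c s → Outside c t → Far t s
  far-to-leaf leaf outside = DistGE-sym (λ {u} {v} → TAdj-sym {suc m} {u} {v}) (far-from-leaf leaf outside)

  leaf-outside : ∀ {c d s} → d ≢ c → Leaf c s → Outside d s
  leaf-outside d≢c (s-inside , _) s-in-d = d≢c (just-injective (trans (sym s-in-d) s-inside))

  zigzag-Linked : ∀ c d → d ≢ c → ∀ {w zs} → (∀ {x} → Leaf c x → Far w x) →
                  (∀ {x} → Leaf c x → Linked Far (x ∷ zs)) → Linked Far (w ∷ zigzag m c d ++ zs)
  zigzag-Linked c d d≢c far-w continue =
    Linked-interleave⁺ far-from-leaf far-to-leaf far-w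
      (All-map⁺ (All.map (λ |l|≡m → refl , cong suc |l|≡m) (All-strings m)))
      (All-map⁺ (All.universal (λ _ → d≢c ∘ just-injective) (below m)))
      (trans (length-map _ (strings m)) (trans (length-strings m) (cong suc (sym (length-map _ (below m))))))
      continue

  labels-Linked : Linked Far (labels m)
  labels-Linked = zigzag-Linked true false (λ ()) (λ leaf → far-to-leaf leaf (λ ())) continue
    where
    continue : ∀ {x} → Leaf true x → Linked Far (x ∷ zigzag m false true)
    continue x-leaf = subst (λ zs → Linked Far (_ ∷ zs)) (++-identityʳ (zigzag m false true))
      (zigzag-Linked false true (λ ()) (far-from-leaf x-leaf ∘ leaf-outside (λ ())) (λ _ → [-]))

  lower-bound : HasDispersed (TAdj (suc m)) (suc m)
  lower-bound = length (labels m) , lookup⤖ (labels m) labels-bounded count-labels ≤-irrelevant ,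
                λ i j j≡1+i → Linked-lookup labels-Linked i j j≡1+i

theorem2p18 : ∀ (n : ℕ) → 1 ≤ n → IsDL (TAdj n) n
theorem2p18 (suc m) _ =
  lower-bound m ,
  λ k → dispersion≤eccentricity (λ {u} {v} → TAdj-sym {suc m} {u} {v}) root ([ true ] , s≤s z≤n) (λ ())
          (λ (s , p) → length s , p , walk-from-root s p)
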